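{- Let $\mathcal X\neq\emptyset$ be a set of variables. For every formula $\phi\in\mathsf{FORM}_{\mathcal X}$, the following are equivalent: 1. $\phi$ is a tautology, i.e. $\hat\phi(v)=1/2$ for all $v\in\mathfrak Z^{\mathcal X}$; 2. $0\models_\Diamond\phi$ and $\partial(1/2,0)\models_\Diamond\phi$; 3. $\alpha\sqcup\partial(1/2,\alpha)\models_\Diamond\phi$ for some formula $\alpha$; 4. $\beta\models_\Diamond\phi$ for every formula $\beta$.
   Context: Let $\mathfrak Z=\{0,1/2,1\}$, with the following binary operations. - $x\wedge y=\min(x,y)$. - $x\sqcup y=x$ if $x=y$, and $x\sqcup y=1/2$ otherwise. - $\partial(x,y)=1/2$ if $y=1/2$. If $y\in\{0,1\}$, then $\partial(x,y)=y$ when $x=y$, and $\partial(x,y)=1-y$ when $x\ne y$. $\mathsf{FORM}_{\mathcal X}$ is the set of formulas built from the variables in $\mathcal X$ and the constant symbols $0,1/2$ using the connectives $\sqcup,\partial,\wedge$. For $v\in\mathfrak Z^{\mathcal X}$, $\hat\phi(v)$ is the induced value of $\phi$. For single formulas, $\theta\models_\Diamond\phi$ means: for every $v$, either $\hat\theta(v)\sqcup\hat\phi(v)=\hat\phi(v)$ or $1/2\sqcup\hat\phi(v)=\hat\phi(v)$. (A singleton premise set is always compatible.) -}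

module Defs where

open import Relation.Binary.PropositionalEquality using (_≡_)
open import Data.Sum using (_⊎_)

-- The three-element set 𝔷 = {0, 1/2, 1}
data Z : Set where
  z0 zh z1 : Z

_∧Z_ : Z → Z → Z
z0 ∧Z y  = z0
zh ∧Z z0 = z0
zh ∧Z zh = zh
zh ∧Z z1 = zh
z1 ∧Z y  = y

_⊔Z_ : Z → Z → Z
z0 ⊔Z z0 = z0
zh ⊔Z zh = zh
z1 ⊔Z z1 = z1
_  ⊔Z _  = zh

∂Z : Z → Z → Z
∂Z x  zh = zh
∂Z z0 z0 = z0
∂Z zh z0 = z1
∂Z z1 z0 = z1
∂Z z1 z1 = z1
∂Z zh z1 = z0
∂Z z0 z1 = z0

data Form (X : Set) : Set where
  var  : X → Form X
  c0   : Form X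
  ch   : Form X
  _⊔F_ : Form X → Form X → Form X
  ∂F   : Form X → Form X → Form X
  _∧F_ : Form X → Form X → Form X

⟦_⟧ : {X : Set} → Form X → (X → Z) → Z
⟦ var x ⟧ v   = v x
⟦ c0 ⟧ v      = z0
⟦ ch ⟧ v      = zh
⟦ φ ⊔F ψ ⟧ v  = ⟦ φ ⟧ v ⊔Z ⟦ ψ ⟧ v
⟦ ∂F φ ψ ⟧ v  = ∂Z (⟦ φ ⟧ v) (⟦ ψ ⟧ v)
⟦ φ ∧F ψ ⟧ v  = ⟦ φ ⟧ v ∧Z ⟦ ψ ⟧ v

Tautology : {X : Set} → Form X → Set
Tautology φ = ∀ v → ⟦ φ ⟧ v ≡ zh

_⊨◇_ : {X : Set} → Form X → Form X → Set
θ ⊨◇ φ = ∀ v → ((⟦ θ ⟧ v ⊔Z ⟦ φ ⟧ v) ≡ ⟦ φ ⟧ v) ⊎ ((zh ⊔Z ⟦ φ ⟧ v) ≡ ⟦ φ ⟧ v)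

-- Only the value 1/2 absorbs every premise value: a premise value t entails f
-- iff t ⊔ f = f or f = 1/2, and t ⊔ f = f forces f = t unless f = 1/2.  So the
-- premises 0 and ∂(1/2, 0) = 1 together, or the premise α ⊔ ∂(1/2, α), whose
-- value is always 1/2, force every value of φ to be 1/2.
module Submission where

open import Defs
open import Data.Product using (_×_; Σ; _,_)
open import Function.Bundles using (_⇔_; mk⇔)
open import Data.Sum using (_⊎_; inj₁; inj₂)
open import Relation.Binary.PropositionalEquality using (_≡_; refl; subst; sym)

_⊨ᶻ_ : Z → Z → Set
t ⊨ᶻ f = ((t ⊔Z f) ≡ f) ⊎ ((zh ⊔Z f) ≡ f)

⊨ᶻ-zh : ∀ t → t ⊨ᶻ zh
⊨ᶻ-zh t = inj₂ refl

z0∧z1-⊨ᶻ⇒≡zh : ∀ f → z0 ⊨ᶻ f → z1 ⊨ᶻ f → f ≡ zh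
z0∧z1-⊨ᶻ⇒≡zh z0 _ (inj₁ ())
z0∧z1-⊨ᶻ⇒≡zh z0 _ (inj₂ ())
z0∧z1-⊨ᶻ⇒≡zh zh _ _ = refl
z0∧z1-⊨ᶻ⇒≡zh z1 (inj₁ ()) _
z0∧z1-⊨ᶻ⇒≡zh z1 (inj₂ ()) _

zh-⊨ᶻ⇒≡zh : ∀ f → zh ⊨ᶻ f → f ≡ zh
zh-⊨ᶻ⇒≡zh z0 (inj₁ ())
zh-⊨ᶻ⇒≡zh z0 (inj₂ ())
zh-⊨ᶻ⇒≡zh zh _ = refl
zh-⊨ᶻ⇒≡zh z1 (inj₁ ())
zh-⊨ᶻ⇒≡zh z1 (inj₂ ())

⊔Z-∂Z-zh-self : ∀ a → a ⊔Z ∂Z zh a ≡ zh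
⊔Z-∂Z-zh-self z0 = refl
⊔Z-∂Z-zh-self zh = refl
⊔Z-∂Z-zh-self z1 = refl

module _ {X : Set} (φ : Form X) where

  tautology⇒⊨◇ : Tautology φ → (θ : Form X) → θ ⊨◇ φ
  tautology⇒⊨◇ taut θ v = subst (⟦ θ ⟧ v ⊨ᶻ_) (sym (taut v)) (⊨ᶻ-zh _)

  c0∧∂chc0-⊨◇⇒tautology : c0 ⊨◇ φ → ∂F ch c0 ⊨◇ φ → Tautology φ
  c0∧∂chc0-⊨◇⇒tautology ⊨₀ ⊨₁ v = z0∧z1-⊨ᶻ⇒≡zh (⟦ φ ⟧ v) (⊨₀ v) (⊨₁ v)

  ⊔∂-⊨◇⇒tautology : (α : Form X) → (α ⊔F ∂F ch α) ⊨◇ φ → Tautology φ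
  ⊔∂-⊨◇⇒tautology α ⊨α v =
    zh-⊨ᶻ⇒≡zh (⟦ φ ⟧ v) (subst (_⊨ᶻ ⟦ φ ⟧ v) (⊔Z-∂Z-zh-self (⟦ α ⟧ v)) (⊨α v))

proposition5p4 : (X : Set) → X → (φ : Form X) →
    (Tautology φ ⇔ ((c0 ⊨◇ φ) × (∂F ch c0 ⊨◇ φ)))
    × (Tautology φ ⇔ Σ (Form X) (λ α → (α ⊔F ∂F ch α) ⊨◇ φ))
    × (Tautology φ ⇔ ((β : Form X) → β ⊨◇ φ))
proposition5p4 X _ φ =
    mk⇔ (λ taut → tautology⇒⊨◇ φ taut c0 , tautology⇒⊨◇ φ taut (∂F ch c0))
        (λ { (⊨₀ , ⊨₁) → c0∧∂chc0-⊨◇⇒tautology φ ⊨₀ ⊨₁ })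
  , mk⇔ (λ taut → c0 , tautology⇒⊨◇ φ taut (c0 ⊔F ∂F ch c0))
        (λ { (α , ⊨α) → ⊔∂-⊨◇⇒tautology φ α ⊨α })
  , mk⇔ (tautology⇒⊨◇ φ)
        (λ ⊨all → c0∧∂chc0-⊨◇⇒tautology φ (⊨all c0) (⊨all (∂F ch c0)))
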